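{- For all $n\in\mathbb N$: $$\sum_{k=0}^{n-1}\frac1{2k+1}\left[{2k\atop1}\right]=\left[{2n\atop1}\right]-\frac2\pi,\qquad \sum_{k=0}^{n-1}\frac1{2k+2}\left[{2k+1\atop1}\right]=\left[{2n+1\atop1}\right]-1,$$ $$\sum_{k=0}^n\left[{k\atop2}\right]=\frac{n(n+1)}4,\qquad \sum_{k=1}^n\frac1k\left[{k\atop2}\right]=\frac n2,\qquad \sum_{k=0}^n\frac1{k+1}\left[{k\atop2}\right]=\frac{n+1}2-\frac12H_{n+1},$$ where $H_m=\sum_{j=1}^m\frac1j$ is the $m$-th harmonic number.
   Context: $\mathbb N=\{0,1,2,\dots\}$. For $n,k\in\mathbb Z$ define the $1/2$-binomial coefficient $$\left[{n\atop k}\right]:=\frac{\Gamma(\frac n2+1)}{\Gamma(\frac k2+1)\,\Gamma(\frac{n-k}2+1)},$$ where $\Gamma$ is Euler's Gamma function, with the convention $1/\Gamma(z)=0$ for $z\in\mathbb Z_{\le0}$; in particular the coefficient is $0$ whenever $(n-k)/2\in\mathbb Z_{\le-1}$ or $k/2\in\mathbb Z_{\le -1}$. -}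

module Defs where

open import Data.Nat as ℕ using (ℕ; zero; suc)
open import Data.Integer as ℤ using (ℤ; +_; -[1+_])
open import Data.Rational as ℚ using (ℚ; _/_; 0ℚ; 1ℚ)
open import Data.Product using (_×_; _,_; proj₁; proj₂)
open import Relation.Nullary.Decidable using (does)
open import Data.Bool using (if_then_else_)
open import Relation.Binary.PropositionalEquality using (_≡_)

-- Values of Γ (and 1/Γ) at half-integers are of the form c · (√π)^e with
-- c rational and e an integer.  A "monomial" (c , e) stands for c · (√π)^e.
Mono : Set
Mono = ℚ × ℤ

_*M_ : Mono → Mono → Mono
(c , e) *M (d , f) = (c ℚ.* d , e ℤ.+ f)

scaleM : ℚ → Mono → Mono
scaleM q (c , e) = (q ℚ.* c , e)

-- Γ((m+1)/2) for m : ℕ, via Γ(1/2) = √π, Γ(1) = 1, Γ(z+1) = z Γ(z).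
gammaHalf : ℕ → Mono
gammaHalf zero = (1ℚ , + 1)
gammaHalf (suc zero) = (1ℚ , + 0)
gammaHalf (suc (suc m)) = scaleM ((+ suc m) / 2) (gammaHalf m)

-- 1/Γ(m/2) for m : ℤ, via 1/Γ(1/2) = (√π)^(-1), 1/Γ(1) = 1,
-- 1/Γ(z+1) = (1/z)·1/Γ(z) for z > 0, 1/Γ(z) = z · 1/Γ(z+1) for z < 0,
-- and 1/Γ(0) = 0 (convention 1/Γ = 0 at nonpositive integers).
rGammaHalf : ℤ → Mono
rGammaHalf (+ zero) = (0ℚ , + 0)
rGammaHalf (+ suc zero) = (1ℚ , -[1+ 0 ])
rGammaHalf (+ suc (suc zero)) = (1ℚ , + 0)
rGammaHalf (+ suc (suc (suc m))) = scaleM ((+ 2) / suc m) (rGammaHalf (+ suc m))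
rGammaHalf -[1+ zero ] = scaleM (ℚ.- ((+ 1) / 2)) (rGammaHalf (+ 1))
rGammaHalf -[1+ suc zero ] = scaleM (ℚ.- 1ℚ) (rGammaHalf (+ 0))
rGammaHalf -[1+ suc (suc t) ] = scaleM (ℚ.- ((+ suc (suc (suc t))) / 2)) (rGammaHalf -[1+ t ])

-- The ring ℚ[√π, 1/√π] ⊂ ℝ (π is transcendental, so this is the Laurent
-- polynomial ring), an element being given by its coefficient function
-- i ↦ coefficient of (√π)^i.
L : Set
L = ℤ → ℚ

_≈L_ : L → L → Set
f ≈L g = ∀ i → f i ≡ g i

infix 4 _≈L_
infixl 6 _+L_ _-L_

_+L_ : L → L → L
(f +L g) i = f i ℚ.+ g i

_-L_ : L → L → L
(f -L g) i = f i ℚ.- g i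

scaleL : ℚ → L → L
scaleL q f i = q ℚ.* f i

0L : L
0L _ = 0ℚ

monoL : Mono → L
monoL (c , e) i = if does (i ℤ.≟ e) then c else 0ℚ

ofℚ : ℚ → L
ofℚ q = monoL (q , + 0)

twoOverπ : L
twoOverπ = monoL ((+ 2) / 1 , -[1+ 1 ])

-- 1/2-binomial coefficient [n k] = Γ(n/2+1) / (Γ(k/2+1) Γ((n-k)/2+1)), n ∈ ℕ, k ∈ ℤ.
hbinom : ℕ → ℤ → L
hbinom n k = monoL (gammaHalf (suc n) *M (rGammaHalf (k ℤ.+ + 2) *M rGammaHalf ((+ n ℤ.- k) ℤ.+ + 2)))

sumL : ℕ → (ℕ → L) → L
sumL zero f = 0L
sumL (suc n) f = sumL n f +L f n

harmonic : ℕ → ℚ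
harmonic zero = 0ℚ
harmonic (suc m) = harmonic m ℚ.+ ((+ 1) / suc m)

-- Every 1/2-binomial coefficient occurring here is a rational multiple of
-- a power of √π, so each identity lives in a single coefficient of the
-- Laurent ring ℚ[√π, 1/√π], and each is a telescoping sum.  With
-- Γ(z + 1) = z Γ(z) one gets [m+2 1] = (m+2)/(m+1) · [m 1], i.e.
-- [m 1]/(m+1) = [m+2 1] − [m 1], which telescopes from [0 1] = 2/π and
-- [1 1] = 1; and [k 2] = Γ(k/2 + 1)/Γ(k/2) = k/2, which turns the remaining
-- three sums into sums of rationals with closed-form partial sums.

module Submission where

open import Defs
open import Data.Nat using (ℕ; suc; _*_; _+_)
open import Data.Integer using (+_)
open import Data.Rational using (_/_; 1ℚ)
import Data.Rational as Q
open import Data.Product using (_×_)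

open import Data.Nat using (zero)
open import Data.Product using (_,_)
import Data.Nat.Properties as ℕ
open import Data.Bool using (true; false)
open import Data.Rational using (ℚ; 0ℚ; fromℚᵘ)
open import Data.Rational.Properties
  using (toℚᵘ-injective; toℚᵘ-fromℚᵘ; toℚᵘ-homo-+; toℚᵘ-homo-*; fromℚᵘ-cong;
         +-inverseʳ; +-identityʳ; *-zeroʳ; *-assoc; *-identityʳ; +-*-commutativeRing)
  renaming (_≟_ to _≟ℚ_)
import Data.Rational.Unnormalised as ℚᵘ
import Data.Rational.Unnormalised.Properties as ℚᵘ
import Data.Integer as ℤ
open import Data.Integer.Properties using (pos-+; pos-*)
open import Relation.Nullary.Decidable using (does; dec⇒maybe)
open import Relation.Binary.PropositionalEquality
open import Level using (0ℓ)
open import Tactic.RingSolver using (solve-∀)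
open import Tactic.RingSolver.Core.AlmostCommutativeRing
  using (AlmostCommutativeRing; fromCommutativeRing)
import Data.Nat.Tactic.RingSolver as ℕ-Solver
import Data.Integer.Tactic.RingSolver as ℤ-Solver

ℚ-ring : AlmostCommutativeRing 0ℓ 0ℓ
ℚ-ring = fromCommutativeRing +-*-commutativeRing (λ x → dec⇒maybe (0ℚ ≟ℚ x))

fromℚᵘ-homo-+ : ∀ p q → fromℚᵘ (p ℚᵘ.+ q) ≡ fromℚᵘ p Q.+ fromℚᵘ q
fromℚᵘ-homo-+ p q = toℚᵘ-injective (ℚᵘ.≃-trans (toℚᵘ-fromℚᵘ (p ℚᵘ.+ q))
  (ℚᵘ.≃-sym (ℚᵘ.≃-trans (toℚᵘ-homo-+ (fromℚᵘ p) (fromℚᵘ q))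
    (ℚᵘ.+-cong (toℚᵘ-fromℚᵘ p) (toℚᵘ-fromℚᵘ q)))))

fromℚᵘ-homo-* : ∀ p q → fromℚᵘ (p ℚᵘ.* q) ≡ fromℚᵘ p Q.* fromℚᵘ q
fromℚᵘ-homo-* p q = toℚᵘ-injective (ℚᵘ.≃-trans (toℚᵘ-fromℚᵘ (p ℚᵘ.* q))
  (ℚᵘ.≃-sym (ℚᵘ.≃-trans (toℚᵘ-homo-* (fromℚᵘ p) (fromℚᵘ q))
    (ℚᵘ.*-cong (toℚᵘ-fromℚᵘ p) (toℚᵘ-fromℚᵘ q)))))

-- By definition  + a / suc b = fromℚᵘ (mkℚᵘ (+ a) b), which reduces the
-- arithmetic of such fractions to that of ℚᵘ and then of ℕ.

/-cross : ∀ {b d} a c → a * suc d ≡ c * suc b → + a / suc b ≡ + c / suc d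
/-cross {b} {d} a c eq = fromℚᵘ-cong {ℚᵘ.mkℚᵘ (+ a) b} {ℚᵘ.mkℚᵘ (+ c) d} (ℚᵘ.*≡* (begin
  + a ℤ.* + suc d  ≡⟨ pos-* a (suc d) ⟨
  + (a * suc d)    ≡⟨ cong +_ eq ⟩
  + (c * suc b)    ≡⟨ pos-* c (suc b) ⟩
  + c ℤ.* + suc b  ∎))
  where open ≡-Reasoning

/-+ : ∀ a b c d → + a / suc b Q.+ + c / suc d ≡ + (a * suc d + c * suc b) / (suc b * suc d)
/-+ a b c d = begin
  + a / suc b Q.+ + c / suc d                       ≡⟨ fromℚᵘ-homo-+ (ℚᵘ.mkℚᵘ (+ a) b) (ℚᵘ.mkℚᵘ (+ c) d) ⟨
  (+ a ℤ.* + suc d ℤ.+ + c ℤ.* + suc b) / (suc b * suc d)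
    ≡⟨ cong (λ n → n / (suc b * suc d)) (cong₂ ℤ._+_ (pos-* a (suc d)) (pos-* c (suc b))) ⟨
  (+ (a * suc d) ℤ.+ + (c * suc b)) / (suc b * suc d) ≡⟨ cong (λ n → n / (suc b * suc d)) (pos-+ (a * suc d) (c * suc b)) ⟨
  + (a * suc d + c * suc b) / (suc b * suc d)         ∎
  where open ≡-Reasoning

/-* : ∀ a b c d → (+ a / suc b) Q.* (+ c / suc d) ≡ + (a * c) / (suc b * suc d)
/-* a b c d = begin
  (+ a / suc b) Q.* (+ c / suc d)       ≡⟨ fromℚᵘ-homo-* (ℚᵘ.mkℚᵘ (+ a) b) (ℚᵘ.mkℚᵘ (+ c) d) ⟨
  (+ a ℤ.* + c) / (suc b * suc d)       ≡⟨ cong (λ n → n / (suc b * suc d)) (pos-* a c) ⟨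
  + (a * c) / (suc b * suc d)           ∎
  where open ≡-Reasoning

/-*-cancel : ∀ a b c → (+ a / suc b) Q.* (+ suc b / suc c) ≡ + a / suc c
/-*-cancel a b c = trans (/-* a b (suc b) c) (/-cross (a * suc b) a (law a b c))
  where
  law : ∀ a b c → a * suc b * suc c ≡ a * (suc b * suc c)
  law = ℕ-Solver.solve-∀

1+1/n : ∀ m → 1ℚ Q.+ + 1 / suc m ≡ + suc (suc m) / suc m
1+1/n m = trans (/-+ 1 0 1 m) (/-cross (1 * suc m + 1 * 1) (suc (suc m)) (law m))
  where
  law : ∀ m → (1 * suc m + 1 * 1) * suc m ≡ suc (suc m) * (1 * suc m)
  law = ℕ-Solver.solve-∀

n/2+1/2 : ∀ k → + k / 2 Q.+ + 1 / 2 ≡ + suc k / 2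
n/2+1/2 k = trans (/-+ k 1 1 1) (/-cross (k * 2 + 1 * 2) (suc k) (law k))
  where
  law : ∀ k → (k * 2 + 1 * 2) * 2 ≡ suc k * (2 * 2)
  law = ℕ-Solver.solve-∀

monoL-scaleM : ∀ q x → monoL (scaleM q x) ≈L scaleL q (monoL x)
monoL-scaleM q (c , e) i with does (i ℤ.≟ e)
... | true  = refl
... | false = sym (*-zeroʳ q)

monoL-+ : ∀ c d e → monoL (c , e) +L monoL (d , e) ≈L monoL (c Q.+ d , e)
monoL-+ c d e i with does (i ℤ.≟ e)
... | true  = refl
... | false = refl

monoL-zero : ∀ e → monoL (0ℚ , e) ≈L 0L
monoL-zero e i with does (i ℤ.≟ e)
... | true  = refl
... | false = refl

sumL-telescope : ∀ (f F : ℕ → L) → (∀ k → F k +L f k ≈L F (suc k)) →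
                 ∀ n → sumL n f ≈L F n -L F 0
sumL-telescope f F step zero    i = sym (+-inverseʳ (F 0 i))
sumL-telescope f F step (suc n) i = begin
  sumL n f i Q.+ f n i                 ≡⟨ cong (Q._+ f n i) (sumL-telescope f F step n i) ⟩
  (F n i Q.- F 0 i) Q.+ f n i          ≡⟨ swap (F n i) (F 0 i) (f n i) ⟩
  (F n i Q.+ f n i) Q.- F 0 i          ≡⟨ cong (Q._- F 0 i) (step n i) ⟩
  F (suc n) i Q.- F 0 i                ∎
  where
  open ≡-Reasoning
  swap : ∀ a b c → (a Q.- b) Q.+ c ≡ (a Q.+ c) Q.- b
  swap = solve-∀ ℚ-ring

sumL-ofℚ : ∀ (f : ℕ → L) (t T : ℕ → ℚ) → T 0 ≡ 0ℚ →
           (∀ k → f k ≈L ofℚ (t k)) → (∀ k → T k Q.+ t k ≡ T (suc k)) →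
           ∀ n → sumL n f ≈L ofℚ (T n)
sumL-ofℚ f t T T0≡0 f≈t partial n i = begin
  sumL n f i                           ≡⟨ sumL-telescope f (λ k → ofℚ (T k)) step n i ⟩
  ofℚ (T n) i Q.- ofℚ (T 0) i          ≡⟨ cong (λ c → ofℚ (T n) i Q.- monoL (c , + 0) i) T0≡0 ⟩
  ofℚ (T n) i Q.- ofℚ 0ℚ i             ≡⟨ cong (λ y → ofℚ (T n) i Q.- y) (monoL-zero (+ 0) i) ⟩
  ofℚ (T n) i Q.+ 0ℚ                   ≡⟨ +-identityʳ (ofℚ (T n) i) ⟩
  ofℚ (T n) i                          ∎
  where
  open ≡-Reasoning
  step : ∀ k → ofℚ (T k) +L f k ≈L ofℚ (T (suc k))
  step k j = trans (cong (ofℚ (T k) j Q.+_) (f≈t k j))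
                   (trans (monoL-+ (T k) (t k) (+ 0) j) (cong (λ c → ofℚ c j) (partial k)))

-- The recursions Γ(z + 1) = z Γ(z) behind gammaHalf and rGammaHalf unfold
-- definitionally; this regroups the two scalars they produce in the shape
-- gammaHalf · (y · rGammaHalf) of hbinom.

scaleM-*M-scaleM : ∀ p q x y z → scaleM p x *M (y *M scaleM q z) ≡ scaleM (p Q.* q) (x *M (y *M z))
scaleM-*M-scaleM p q (c , _) (d , _) (g , _) = cong (_, _) (regroup p q c d g)
  where
  regroup : ∀ p q c d g → (p Q.* c) Q.* (d Q.* (q Q.* g)) ≡ (p Q.* q) Q.* (c Q.* (d Q.* g))
  regroup = solve-∀ ℚ-ring

hbinom-one : ∀ m → hbinom m (+ 1) ≈L monoL (gammaHalf (suc m) *M (rGammaHalf (+ 3) *M rGammaHalf (+ suc m)))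
hbinom-one m i = cong (λ j → monoL (gammaHalf (suc m) *M (rGammaHalf (+ 3) *M rGammaHalf j)) i) (index m)
  where
  shift : ∀ x → (x ℤ.- + 1) ℤ.+ + 2 ≡ x ℤ.+ + 1
  shift = ℤ-Solver.solve-∀
  index : ∀ m → (+ m ℤ.- + 1) ℤ.+ + 2 ≡ + suc m
  index m = trans (shift (+ m)) (cong +_ (ℕ.+-comm m 1))

hbinom-one-step : ∀ m → hbinom (2 + m) (+ 1) ≈L scaleL (+ (2 + m) / (1 + m)) (hbinom m (+ 1))
hbinom-one-step m i = begin
  hbinom (2 + m) (+ 1) i                       ≡⟨ hbinom-one (2 + m) i ⟩
  monoL (scaleM p G *M (R₃ *M scaleM q R)) i   ≡⟨ cong (λ x → monoL x i) (scaleM-*M-scaleM p q G R₃ R) ⟩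
  monoL (scaleM (p Q.* q) (G *M (R₃ *M R))) i  ≡⟨ cong (λ s → monoL (scaleM s (G *M (R₃ *M R))) i) (/-*-cancel (2 + m) 1 m) ⟩
  monoL (scaleM r (G *M (R₃ *M R))) i          ≡⟨ monoL-scaleM r (G *M (R₃ *M R)) i ⟩
  r Q.* monoL (G *M (R₃ *M R)) i               ≡⟨ cong (r Q.*_) (hbinom-one m i) ⟨
  r Q.* hbinom m (+ 1) i                       ∎
  where
  open ≡-Reasoning
  p q r : ℚ
  p = + (2 + m) / 2
  q = + 2 / (1 + m)
  r = + (2 + m) / (1 + m)
  G R₃ R : Mono
  G  = gammaHalf (suc m)
  R₃ = rGammaHalf (+ 3)
  R  = rGammaHalf (+ suc m)

-- [k 2] = Γ(k/2 + 1) / (Γ(2) Γ(k/2)) = k/2, and also 0 at k = 0 since 1/Γ(0) = 0.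
hbinom-two-mono : ∀ k → gammaHalf (suc k) *M (rGammaHalf (+ 4) *M rGammaHalf (+ k)) ≡ (+ k / 2 , + 0)
hbinom-two-mono 0 = refl
hbinom-two-mono 1 = refl
hbinom-two-mono 2 = refl
hbinom-two-mono (suc (suc (suc m))) = begin
  scaleM p G *M (R₄ *M scaleM q R)     ≡⟨ scaleM-*M-scaleM p q G R₄ R ⟩
  scaleM (p Q.* q) (G *M (R₄ *M R))    ≡⟨ cong (scaleM (p Q.* q)) (hbinom-two-mono (suc m)) ⟩
  ((p Q.* q) Q.* (+ suc m / 2) , + 0)  ≡⟨ cong (_, + 0) (*-assoc p q (+ suc m / 2)) ⟩
  (p Q.* (q Q.* (+ suc m / 2)) , + 0)  ≡⟨ cong (λ r → (p Q.* r , + 0)) (/-*-cancel 2 m 1) ⟩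
  (p Q.* 1ℚ , + 0)                     ≡⟨ cong (_, + 0) (*-identityʳ p) ⟩
  (p , + 0)                            ∎
  where
  open ≡-Reasoning
  p q : ℚ
  p = + (3 + m) / 2
  q = + 2 / (1 + m)
  G R₄ R : Mono
  G  = gammaHalf (suc (suc m))
  R₄ = rGammaHalf (+ 4)
  R  = rGammaHalf (+ suc m)

hbinom-two : ∀ k → hbinom k (+ 2) ≈L ofℚ (+ k / 2)
hbinom-two k i = trans
  (cong (λ j → monoL (gammaHalf (suc k) *M (rGammaHalf (+ 4) *M rGammaHalf j)) i) (index (+ k)))
  (cong (λ x → monoL x i) (hbinom-two-mono k))
  where
  index : ∀ x → (x ℤ.- + 2) ℤ.+ + 2 ≡ x
  index = ℤ-Solver.solve-∀

sum-hbinom-one : ∀ j n →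
  sumL n (λ k → scaleL (+ 1 / suc (j + 2 * k)) (hbinom (j + 2 * k) (+ 1)))
    ≈L hbinom (j + 2 * n) (+ 1) -L hbinom j (+ 1)
sum-hbinom-one j n i = trans (sumL-telescope _ (λ k → hbinom (j + 2 * k) (+ 1)) step n i)
  (cong (λ j′ → hbinom (j + 2 * n) (+ 1) i Q.- hbinom j′ (+ 1) i) (ℕ.+-identityʳ j))
  where
  index : ∀ j k → 2 + (j + 2 * k) ≡ j + 2 * suc k
  index = ℕ-Solver.solve-∀
  step : ∀ k → hbinom (j + 2 * k) (+ 1) +L scaleL (+ 1 / suc (j + 2 * k)) (hbinom (j + 2 * k) (+ 1))
                 ≈L hbinom (j + 2 * suc k) (+ 1)
  step k i = begin
    x Q.+ + 1 / suc m Q.* x            ≡⟨ distrib x (+ 1 / suc m) ⟩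
    (1ℚ Q.+ + 1 / suc m) Q.* x         ≡⟨ cong (Q._* x) (1+1/n m) ⟩
    + (2 + m) / (1 + m) Q.* x          ≡⟨ hbinom-one-step m i ⟨
    hbinom (2 + m) (+ 1) i             ≡⟨ cong (λ m′ → hbinom m′ (+ 1) i) (index j k) ⟩
    hbinom (j + 2 * suc k) (+ 1) i     ∎
    where
    open ≡-Reasoning
    m = j + 2 * k
    x = hbinom m (+ 1) i
    distrib : ∀ x y → x Q.+ y Q.* x ≡ (1ℚ Q.+ y) Q.* x
    distrib = solve-∀ ℚ-ring

sum-hbinom-two : ∀ n → sumL (suc n) (λ k → hbinom k (+ 2)) ≈L ofℚ (+ (n * suc n) / 4)
sum-hbinom-two n = sumL-ofℚ _ (λ k → + k / 2) T refl hbinom-two partial (suc n)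
  where
  T : ℕ → ℚ
  T 0       = 0ℚ
  T (suc n) = + (n * suc n) / 4
  law : ∀ n → (n * suc n * 2 + suc n * 4) * 4 ≡ suc n * suc (suc n) * (4 * 2)
  law = ℕ-Solver.solve-∀
  partial : ∀ k → T k Q.+ + k / 2 ≡ T (suc k)
  partial 0       = refl
  partial (suc n) = trans (/-+ (n * suc n) 3 (suc n) 1)
    (/-cross (n * suc n * 2 + suc n * 4) (suc n * suc (suc n)) (law n))

sum-hbinom-two/k : ∀ n → sumL n (λ k → scaleL (+ 1 / suc k) (hbinom (suc k) (+ 2))) ≈L ofℚ (+ n / 2)
sum-hbinom-two/k = sumL-ofℚ _ (λ _ → + 1 / 2) (λ k → + k / 2) refl term n/2+1/2
  where
  term : ∀ k → scaleL (+ 1 / suc k) (hbinom (suc k) (+ 2)) ≈L ofℚ (+ 1 / 2)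
  term k i = trans (cong ((+ 1 / suc k) Q.*_) (hbinom-two (suc k) i))
    (trans (sym (monoL-scaleM (+ 1 / suc k) (+ suc k / 2 , + 0) i))
           (cong (λ c → ofℚ c i) (/-*-cancel 1 k 1)))

-- k/(2(k+1)) = 1/2 − 1/(2(k+1)) makes the harmonic numbers appear.
sum-hbinom-two/k+1 : ∀ n → sumL (suc n) (λ k → scaleL (+ 1 / suc k) (hbinom k (+ 2)))
                           ≈L ofℚ (+ suc n / 2 Q.- + 1 / 2 Q.* harmonic (suc n))
sum-hbinom-two/k+1 n = sumL-ofℚ _ t T refl term partial (suc n)
  where
  t T : ℕ → ℚ
  t k = (+ 1 / suc k) Q.* (+ k / 2)
  T k = + k / 2 Q.- + 1 / 2 Q.* harmonic k
  term : ∀ k → scaleL (+ 1 / suc k) (hbinom k (+ 2)) ≈L ofℚ (t k)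
  term k i = trans (cong ((+ 1 / suc k) Q.*_) (hbinom-two k i))
    (sym (monoL-scaleM (+ 1 / suc k) (+ k / 2 , + 0) i))
  rearrange : ∀ a h H x → (a Q.- h Q.* H) Q.+ x Q.* a ≡ (a Q.+ x Q.* (a Q.+ h)) Q.- h Q.* (H Q.+ x)
  rearrange = solve-∀ ℚ-ring
  partial : ∀ k → T k Q.+ t k ≡ T (suc k)
  partial k = begin
    (a Q.- h Q.* H) Q.+ x Q.* a                 ≡⟨ rearrange a h H x ⟩
    (a Q.+ x Q.* (a Q.+ h)) Q.- h Q.* (H Q.+ x) ≡⟨ cong (λ s → (a Q.+ x Q.* s) Q.- h Q.* (H Q.+ x)) (n/2+1/2 k) ⟩
    (a Q.+ x Q.* (+ suc k / 2)) Q.- h Q.* (H Q.+ x)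
      ≡⟨ cong (λ s → (a Q.+ s) Q.- h Q.* (H Q.+ x)) (/-*-cancel 1 k 1) ⟩
    (a Q.+ h) Q.- h Q.* (H Q.+ x)               ≡⟨ cong (Q._- h Q.* (H Q.+ x)) (n/2+1/2 k) ⟩
    + suc k / 2 Q.- h Q.* (H Q.+ x)             ∎
    where
    open ≡-Reasoning
    a = + k / 2
    h = + 1 / 2
    H = harmonic k
    x = + 1 / suc k

mainTheorem11 : ∀ (n : ℕ) →
      (sumL n (λ k → scaleL ((+ 1) / suc (2 * k)) (hbinom (2 * k) (+ 1)))
         ≈L hbinom (2 * n) (+ 1) -L twoOverπ)
    × (sumL n (λ k → scaleL ((+ 1) / suc (suc (2 * k))) (hbinom (suc (2 * k)) (+ 1)))
         ≈L hbinom (suc (2 * n)) (+ 1) -L ofℚ 1ℚ)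
    × (sumL (suc n) (λ k → hbinom k (+ 2))
         ≈L ofℚ ((+ (n * suc n)) / 4))
    × (sumL n (λ k → scaleL ((+ 1) / suc k) (hbinom (suc k) (+ 2)))
         ≈L ofℚ ((+ n) / 2))
    × (sumL (suc n) (λ k → scaleL ((+ 1) / suc k) (hbinom k (+ 2)))
         ≈L ofℚ (((+ suc n) / 2) Q.- ((+ 1) / 2) Q.* harmonic (suc n)))
mainTheorem11 n =
  -- [0 1] = 2/π and [1 1] = 1 hold by computation.
    sum-hbinom-one 0 n
  , sum-hbinom-one 1 n
  , sum-hbinom-two n
  , sum-hbinom-two/k n
  , sum-hbinom-two/k+1 n
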